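{- For every $n \geq 2$, the listings $\mathrm{LIST}_n$ and $\mathrm{REVLIST}_n$ (defined in the context) each consist of exactly $t_n$ trees, where $t_n$ is the number of spanning trees of the fan graph $F_n$.
   Context: For $n\ge 2$, the fan graph $F_n$ has vertices $v_2,\dots,v_n$ and $v_\infty$; its edges are $v_iv_{i+1}$ for $2\le i\le n-1$ and $v_iv_\infty$ for $2\le i\le n$. Let $t_n$ denote the number of spanning trees of $F_n$. Let $P_n$ be the spanning tree that is the path $v_\infty, v_2, v_3,\dots,v_n$. The procedures below act on a global variable $T$, a spanning tree of $F_n$. "$T \leftarrow T - a + b$" means: delete edge $a$ from $T$ and add edge $b$; "print $T$" appends the current $T$ to the output listing. Procedure $\mathrm{Gen}(k,s_1,\mathit{varEdge})$ (with $s_1,\mathit{varEdge}\in\{0,1\}$): - If $k=2$: if $\mathit{varEdge}=1$, do $T\leftarrow T - v_2v_\infty + v_2v_3$ and print $T$. - If $k=3$: if $s_1=1$, then (if $\mathit{varEdge}=1$ do $T\leftarrow T - v_3v_2+v_3v_4$, otherwise do $T\leftarrow T-v_3v_2+v_3v_\infty$) and print $T$; then (in all cases) do $T\leftarrow T-v_2v_\infty+v_2v_3$ and print $T$. - If $k\ge 4$: (i) if $s_1=1$: call $\mathrm{Gen}(k-1,1,0)$; then if $\mathit{varEdge}=1$ do $T\leftarrow T-v_kv_{k-1}+v_kv_{k+1}$, otherwise do $T\leftarrow T-v_kv_{k-1}+v_kv_\infty$; print $T$. (ii) Call $\mathrm{RevGen}(k-1,1,0)$; do $T\leftarrow T-v_{k-1}v_{k-2}+v_{k-1}v_k$;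 print $T$. (iii) Call $\mathrm{Gen}(k-2,1,1)$; if $k>4$, do $T\leftarrow T-v_{k-2}v_{k-1}+v_{k-2}v_\infty$ and print $T$. (iv) Call $\mathrm{RevGen}(k-2,0,0)$. The sequence of edge operations performed by $\mathrm{Gen}(k,s_1,\mathit{varEdge})$ depends only on its parameters. Procedure $\mathrm{RevGen}(k,s_1,\mathit{varEdge})$ performs the inverse operations of that sequence in reverse order (an operation $T\leftarrow T-a+b$ is undone by $T\leftarrow T-b+a$), printing $T$ after each one. $\mathrm{LIST}_n$ is the listing obtained by setting $T:=P_n$, printing $T$, and calling $\mathrm{Gen}(n,1,0)$. Let $L_n$ be the last tree of $\mathrm{LIST}_n$. $\mathrm{REVLIST}_n$ is the listing obtained by setting $T:=L_n$, printing $T$, and calling $\mathrm{RevGen}(n,1,0)$. This is $\mathrm{LIST}_n$ in reverse order. -}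

module Defs where

open import Data.Nat using (ℕ; zero; suc; _∸_; _+_; _≤_; _<_; _≡ᵇ_)
open import Data.Bool using (Bool; true; false; if_then_else_; _∧_; _∨_)
open import Data.Product using (Σ; _×_; _,_; swap)
open import Data.Sum using (_⊎_)
open import Data.Unit using (⊤)
open import Data.Empty using (⊥)
open import Data.Fin using (Fin)
open import Data.List using (List; []; _∷_; [_]; _++_; length; map; upTo; reverse; foldl)
import Data.List as L
open import Data.Vec using (Vec; []; _∷_)
import Data.Vec as V
open import Data.List.Relation.Unary.Unique.Propositional using (Unique)
open import Data.List.Membership.Propositional using (_∈_)
open import Relation.Binary.PropositionalEquality using (_≡_)
open import Relation.Nullary using (¬_)
open import Function using (_⇔_)

-- Vertices: v∞ and v i (the fan F_n uses v 2 , … , v n).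
data Vtx : Set where
  v∞ : Vtx
  v  : ℕ → Vtx

InF : ℕ → Vtx → Set
InF n v∞    = ⊤
InF n (v i) = (2 ≤ i) × (i ≤ n)

Edge : Set
Edge = Vtx × Vtx

edges : ℕ → List Edge
edges n = map (λ i → (v (2 + i) , v (3 + i))) (upTo (n ∸ 2))
       ++ map (λ i → (v (2 + i) , v∞)) (upTo (n ∸ 1))

-- A set of edges of F_n (a spanning subgraph), as a bit vector indexed
-- by the edge list; this representation is canonical.
EdgeSet : ℕ → Set
EdgeSet n = Vec Bool (length (edges n))

Adj : (n : ℕ) → EdgeSet n → Vtx → Vtx → Set
Adj n S x y = Σ (Fin (length (edges n))) λ j →
  (V.lookup S j ≡ true) × ((L.lookup (edges n) j ≡ (x , y)) ⊎ (L.lookup (edges n) j ≡ (y , x)))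

data Reach (n : ℕ) (S : EdgeSet n) : Vtx → Vtx → Set where
  here : ∀ {x} → Reach n S x x
  step : ∀ {x y z} → Adj n S x y → Reach n S y z → Reach n S x z

Connected : (n : ℕ) → EdgeSet n → Set
Connected n S = ∀ x y → InF n x → InF n y → Reach n S x y

Walk : (n : ℕ) → EdgeSet n → List Vtx → Set
Walk n S (x ∷ y ∷ r) = Adj n S x y × Walk n S (y ∷ r)
Walk n S _           = ⊤

IsCycle : (n : ℕ) → EdgeSet n → List Vtx → Set
IsCycle n S []       = ⊥
IsCycle n S (x ∷ r)  = (3 ≤ length (x ∷ r)) × Unique (x ∷ r) × Walk n S ((x ∷ r) ++ [ x ])

Acyclic : (n : ℕ) → EdgeSet n → Set
Acyclic n S = ¬ (Σ (List Vtx) λ c → IsCycle n S c)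

IsSpanningTree : (n : ℕ) → EdgeSet n → Set
IsSpanningTree n S = Connected n S × Acyclic n S

NumSpanningTrees : ℕ → ℕ → Set
NumSpanningTrees n k = Σ (List (EdgeSet n)) λ Ts →
  Unique Ts × (∀ S → IsSpanningTree n S ⇔ (S ∈ Ts)) × (length Ts ≡ k)

eqV : Vtx → Vtx → Bool
eqV v∞ v∞       = true
eqV (v i) (v j) = i ≡ᵇ j
eqV _ _         = false

sameEdge : Edge → Edge → Bool
sameEdge (a , b) (c , d) = (eqV a c ∧ eqV b d) ∨ (eqV a d ∧ eqV b c)

setBit : (es : List Edge) → Edge → Bool → Vec Bool (length es) → Vec Bool (length es)
setBit []       e b []       = []
setBit (x ∷ es) e b (c ∷ cs) = (if sameEdge x e then b else c) ∷ setBit es e b cs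

mark : (es : List Edge) → (Edge → Bool) → Vec Bool (length es)
mark []       f = []
mark (x ∷ es) f = f x ∷ mark es f

-- An operation (a , b) means  T ← T - a + b.
Op : Set
Op = Edge × Edge

apply : (n : ℕ) → EdgeSet n → Op → EdgeSet n
apply n T (a , b) = setBit (edges n) b true (setBit (edges n) a false T)

revOps : List Op → List Op
revOps os = reverse (map swap os)

-- Gen / RevGen as the sequence of operations they perform
-- (each operation is followed by "print T").

gen : ℕ → Bool → Bool → List Op
gen 0 s ve = []
gen 1 s ve = []
gen 2 s ve = if ve then [ ((v 2 , v∞) , (v 2 , v 3)) ] else []
gen 3 s ve =
  (if s then [ (if ve then ((v 3 , v 2) , (v 3 , v 4)) else ((v 3 , v 2) , (v 3 , v∞))) ] else [])
  ++ [ ((v 2 , v∞) , (v 2 , v 3)) ]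
gen (suc (suc (suc (suc m)))) s ve =
  -- k = m + 4
  (if s
     then gen (suc (suc (suc m))) true false
          ++ [ (if ve then ((v (4 + m) , v (3 + m)) , (v (4 + m) , v (5 + m)))
                      else ((v (4 + m) , v (3 + m)) , (v (4 + m) , v∞))) ]
     else [])
  ++ revOps (gen (suc (suc (suc m))) true false)
  ++ [ ((v (3 + m) , v (2 + m)) , (v (3 + m) , v (4 + m))) ]
  ++ gen (suc (suc m)) true true
  ++ (if isZero m then [] else [ ((v (2 + m) , v (3 + m)) , (v (2 + m) , v∞)) ])
  ++ revOps (gen (suc (suc m)) false false)
  where
  isZero : ℕ → Bool
  isZero zero    = true
  isZero (suc _) = false

revgen : ℕ → Bool → Bool → List Op
revgen k s ve = revOps (gen k s ve)

run : (n : ℕ) → EdgeSet n → List Op → List (EdgeSet n)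
run n T []       = []
run n T (o ∷ os) = apply n T o ∷ run n (apply n T o) os

-- P_n : the path v∞, v2, v3, …, vn.
inPn : Edge → Bool
inPn (v i , v j) = true
inPn (v i , v∞)  = i ≡ᵇ 2
inPn _           = false

Pn : (n : ℕ) → EdgeSet n
Pn n = mark (edges n) inPn

LIST : (n : ℕ) → List (EdgeSet n)
LIST n = Pn n ∷ run n (Pn n) (gen n true false)

Ln : (n : ℕ) → EdgeSet n
Ln n = foldl (apply n) (Pn n) (gen n true false)

REVLIST : (n : ℕ) → List (EdgeSet n)
REVLIST n = Ln n ∷ run n (Ln n) (revgen n true false)

module Submission where

-- Cut the rim v₂ … vₙ of the fan at its missing rim edges into blocks of consecutive
-- vertices.  A spanning subgraph is a spanning tree exactly when every block carries
-- exactly one spoke: a block without a spoke is cut off from the hub, and two spokes of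
-- one block close a cycle through the hub.  Conversely, pointing every vertex towards the
-- spoke of its block, and every spoke vertex to the hub, gives parent pointers which
-- lower a height function and account for every edge, so the subgraph is a tree.
-- Scanning v₂, v₃, …, vₙ, the condition is checked by a two-state automaton remembering
-- whether the current block already has its spoke.  The spanning trees of F_{m+2} thus
-- correspond to the accepted words, and counting those gives the recurrences
--   #spokeless (m+1) = #spoked m + 2 · #spokeless m,   #spoked (m+1) = #spoked m + #spokeless m,
-- which the lengths of the listings produced by Gen satisfy as well.

open import Defs
open import Data.Bool using (Bool; true; false; if_then_else_; _∧_)
open import Data.Bool.Properties using (not-¬)
open import Data.Maybe using (Maybe; just; nothing)
open import Data.Nat using (ℕ; zero; suc; _+_; _∸_; _<_; _≤_; z≤n; s≤s; z<s; s<s; _≟_)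
open import Data.Nat.Properties
open import Data.Nat.Induction using (<-wellFounded)
open import Data.Nat.ListAction using (sum)
open import Data.Nat.Tactic.RingSolver using (solve-∀)
import Data.Fin as Fin
open import Data.List using (List; []; _∷_; [_]; _++_; length; map; concatMap; upTo)
import Data.List as L
open import Data.List.Properties using (length-++; length-map; length-reverse; map-cong)
open import Data.List.Relation.Unary.All using (All; []; _∷_)
import Data.List.Relation.Unary.All as All
open import Data.List.Relation.Unary.Any using (here; there)
import Data.List.Relation.Unary.Any as Any
open import Data.List.Relation.Unary.Any.Properties using (lookup-index)
open import Data.List.Relation.Unary.AllPairs using ([]; _∷_)
open import Data.List.Relation.Unary.Unique.Propositional using (Unique)
open import Data.List.Relation.Unary.Unique.Propositional.Properties using (map⁺; ++⁺; upTo⁺)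
open import Data.List.Membership.Propositional using (_∈_)
open import Data.List.Membership.Propositional.Properties
  using (∈-map⁺; ∈-map⁻; ∈-++⁺ˡ; ∈-++⁺ʳ; ∈-++⁻; ∈-upTo⁺; ∈-upTo⁻; ∈-concatMap⁺; ∈-concatMap⁻)
open import Data.Vec using (Vec; []; _∷_)
import Data.Vec as V
open import Data.Product using (_×_; _,_; ∃; proj₁; proj₂)
import Data.Product as Product
open import Data.Product.Properties using (≡-dec)
open import Data.Sum using (_⊎_; inj₁; inj₂)
import Data.Sum as Sum
open import Data.Empty using (⊥; ⊥-elim)
open import Data.Unit using (⊤; tt)
open import Function using (id; _∘_; _⇔_; mk⇔; Equivalence)
open import Induction.WellFounded using (Acc; acc)
open import Relation.Nullary using (¬_; yes; no; does)
open import Relation.Nullary.Decidable as Dec using (dec-true; dec-false)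
open import Relation.Binary.Definitions using (DecidableEquality)
open import Relation.Binary.PropositionalEquality hiding ([_])

open Equivalence using (to; from)

-- Vertex v₍₂₊ₖ₎ is read as the letter (spoke bit, rim bit) of its edges to v∞ and v₍₃₊ₖ₎.  The phase
-- records whether the current block already has its spoke; a missing rim edge closes the block.
data Phase : Set where
  spokeless spoked : Phase

Letter : Set
Letter = Bool × Bool

letters : List Letter
letters = (true , true) ∷ (true , false) ∷ (false , true) ∷ (false , false) ∷ []

δ : Phase → Letter → Maybe Phase
δ spokeless (true  , rim)   = just (if rim then spoked else spokeless)
δ spokeless (false , true)  = just spokeless
δ spokeless (false , false) = nothing
δ spoked    (true  , _)     = nothing
δ spoked    (false , rim)   = just (if rim then spoked else spokeless)

#words : Phase → ℕ → ℕ
#wordsAfter : Maybe Phase → ℕ → ℕ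
#words q zero    = 1
#words q (suc m) = sum (map (λ l → #wordsAfter (δ q l) m) letters)
#wordsAfter nothing  m = 0
#wordsAfter (just q) m = #words q m

#words-spokeless : ∀ m → #words spokeless (suc m) ≡ #words spoked m + #words spokeless m + #words spokeless m
#words-spokeless m = rearrange (#words spoked m) (#words spokeless m)
  where
  rearrange : ∀ a b → a + (b + (b + (0 + 0))) ≡ a + b + b
  rearrange = solve-∀

#words-spoked : ∀ m → #words spoked (suc m) ≡ #words spoked m + #words spokeless m
#words-spoked m = rearrange (#words spoked m) (#words spokeless m)
  where
  rearrange : ∀ a b → 0 + (0 + (a + (b + 0))) ≡ a + b
  rearrange = solve-∀

length-revOps : ∀ os → length (revOps os) ≡ length os
length-revOps os = trans (length-reverse (map Product.swap os)) (length-map Product.swap os)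

length-shape : ∀ (A G B H C K : List Op) →
  length (A ++ revOps G ++ B ++ H ++ C ++ revOps K)
    ≡ length A + (length G + (length B + (length H + (length C + length K))))
length-shape A G B H C K = begin
    length (A ++ revOps G ++ B ++ H ++ C ++ revOps K)
  ≡⟨ length-++ A ⟩
    length A + length (revOps G ++ B ++ H ++ C ++ revOps K)
  ≡⟨ cong (length A +_) (length-++ (revOps G)) ⟩
    length A + (length (revOps G) + length (B ++ H ++ C ++ revOps K))
  ≡⟨ cong (λ x → length A + (length (revOps G) + x)) (length-++ B) ⟩
    length A + (length (revOps G) + (length B + length (H ++ C ++ revOps K)))
  ≡⟨ cong (λ x → length A + (length (revOps G) + (length B + x))) (length-++ H) ⟩
    length A + (length (revOps G) + (length B + (length H + length (C ++ revOps K))))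
  ≡⟨ cong (λ x → length A + (length (revOps G) + (length B + (length H + x)))) (length-++ C) ⟩
    length A + (length (revOps G) + (length B + (length H + (length C + length (revOps K)))))
  ≡⟨ cong₂ (λ x y → length A + (x + (length B + (length H + (length C + y))))) (length-revOps G) (length-revOps K) ⟩
    length A + (length G + (length B + (length H + (length C + length K))))
  ∎
  where open ≡-Reasoning

length-gen-5+ : ∀ m s ve →
  length (gen (5 + m) s ve) ≡
    (if s then suc (length (gen (4 + m) true false)) else 0)
    + (length (gen (4 + m) true false)
       + suc (length (gen (3 + m) true true) + suc (length (gen (3 + m) false false))))
length-gen-5+ m s ve =
  trans (length-shape (if s then G ++ [ o ] else []) G B H C K)
        (cong (_+ (length G + suc (length H + suc (length K)))) (length-prefix s))
  where
  G = gen (4 + m) true false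
  H = gen (3 + m) true true
  K = gen (3 + m) false false
  o = if ve then ((v (5 + m) , v (4 + m)) , (v (5 + m) , v (6 + m)))
            else ((v (5 + m) , v (4 + m)) , (v (5 + m) , v∞))
  B = [ ((v (4 + m) , v (3 + m)) , (v (4 + m) , v (5 + m))) ]
  C = [ ((v (3 + m) , v (4 + m)) , (v (3 + m) , v∞)) ]
  length-prefix : ∀ s → length (if s then G ++ [ o ] else []) ≡ (if s then suc (length G) else 0)
  length-prefix true  = trans (length-++ G) (+-comm (length G) 1)
  length-prefix false = refl

length-gen : ∀ m s ve → suc (length (gen (3 + m) s ve)) ≡ #words (if s then spokeless else spoked) (suc m)
length-gen zero          true  ve = refl
length-gen zero          false ve = refl
length-gen (suc zero)    true  ve = refl
length-gen (suc zero)    false ve = refl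
length-gen (suc (suc m)) true ve = begin
    suc (length (gen (5 + m) true ve))
  ≡⟨ cong suc (length-gen-5+ m true ve) ⟩
    suc (suc g + (g + suc (h + suc k)))
  ≡⟨ regroup g h k ⟩
    (suc k + suc h) + suc g + suc g
  ≡⟨ cong₂ (λ a b → a + b + b) (cong₂ _+_ (length-gen m false false) (length-gen m true true))
                                (length-gen (suc m) true false) ⟩
    (#words spoked (suc m) + #words spokeless (suc m)) + #words spokeless (2 + m) + #words spokeless (2 + m)
  ≡⟨ cong (λ a → a + #words spokeless (2 + m) + #words spokeless (2 + m)) (#words-spoked (suc m)) ⟨
    #words spoked (2 + m) + #words spokeless (2 + m) + #words spokeless (2 + m)
  ≡⟨ #words-spokeless (2 + m) ⟨
    #words spokeless (3 + m)
  ∎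
  where
  open ≡-Reasoning
  g = length (gen (4 + m) true false)
  h = length (gen (3 + m) true true)
  k = length (gen (3 + m) false false)
  regroup : ∀ g h k → suc (suc g + (g + suc (h + suc k))) ≡ (suc k + suc h) + suc g + suc g
  regroup = solve-∀
length-gen (suc (suc m)) false ve = begin
    suc (length (gen (5 + m) false ve))
  ≡⟨ cong suc (length-gen-5+ m false ve) ⟩
    suc (g + suc (h + suc k))
  ≡⟨ regroup g h k ⟩
    (suc k + suc h) + suc g
  ≡⟨ cong₂ _+_ (cong₂ _+_ (length-gen m false false) (length-gen m true true)) (length-gen (suc m) true false) ⟩
    (#words spoked (suc m) + #words spokeless (suc m)) + #words spokeless (2 + m)
  ≡⟨ cong (_+ #words spokeless (2 + m)) (#words-spoked (suc m)) ⟨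
    #words spoked (2 + m) + #words spokeless (2 + m)
  ≡⟨ #words-spoked (2 + m) ⟨
    #words spoked (3 + m)
  ∎
  where
  open ≡-Reasoning
  g = length (gen (4 + m) true false)
  h = length (gen (3 + m) true true)
  k = length (gen (3 + m) false false)
  regroup : ∀ g h k → suc (g + suc (h + suc k)) ≡ (suc k + suc h) + suc g
  regroup = solve-∀

length-run : ∀ n T os → length (run n T os) ≡ length os
length-run n T []       = refl
length-run n T (o ∷ os) = cong suc (length-run n (apply n T o) os)

length-LIST : ∀ m → length (LIST (2 + m)) ≡ #words spokeless m
length-LIST zero    = refl
length-LIST (suc m) = trans (cong suc (length-run (3 + m) (Pn (3 + m)) (gen (3 + m) true false))) (length-gen m true false)

length-REVLIST : ∀ m → length (REVLIST (2 + m)) ≡ #words spokeless m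
length-REVLIST zero    = refl
length-REVLIST (suc m) = begin
    suc (length (run (3 + m) (Ln (3 + m)) (revgen (3 + m) true false)))
  ≡⟨ cong suc (trans (length-run (3 + m) (Ln (3 + m)) (revgen (3 + m) true false)) (length-revOps (gen (3 + m) true false))) ⟩
    suc (length (gen (3 + m) true false))
  ≡⟨ length-gen m true false ⟩
    #words spokeless (suc m)
  ∎
  where open ≡-Reasoning

length-concatMap : ∀ {A B : Set} (f : A → List B) xs → length (concatMap f xs) ≡ sum (map (length ∘ f) xs)
length-concatMap f []       = refl
length-concatMap f (x ∷ xs) = trans (length-++ (f x)) (cong (length (f x) +_) (length-concatMap f xs))

concatMap-unique : ∀ {A B : Set} {f : A → List B} {xs} → Unique xs → (∀ x → Unique (f x)) →
  (∀ {x x′ y} → y ∈ f x → y ∈ f x′ → x ≡ x′) → Unique (concatMap f xs)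
concatMap-unique []             uf sep = []
concatMap-unique {f = f} {x ∷ xs} (x∉ ∷ u) uf sep = ++⁺ (uf x) (concatMap-unique u uf sep) disjoint
  where
  disjoint : ∀ {y} → y ∈ f x × y ∈ concatMap f xs → ⊥
  disjoint (y∈fx , y∈rest) = All.lookup x∉ (Any.map (sep y∈fx) (∈-concatMap⁻ f y∈rest)) refl

bit : ∀ {n} → Vec Bool n → ℕ → Bool
bit []       _       = false
bit (b ∷ bs) zero    = b
bit (b ∷ bs) (suc k) = bit bs k

-- The rim bits (k < m) and spoke bits (k ≤ m) of a spanning subgraph of F_{m+2}, where k stands for v₍₂₊ₖ₎.
Word : ℕ → Set
Word m = Vec Bool m × Vec Bool (suc m)

cons : ∀ {m} → Letter → Word m → Word (suc m)
cons (s , p) (ps , ss) = (p ∷ ps , s ∷ ss)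

firstLetter : ∀ {m} → Word (suc m) → Letter
firstLetter (p ∷ _ , s ∷ _) = (s , p)

closingSpoke : Phase → Bool
closingSpoke spokeless = true
closingSpoke spoked    = false

Run : (P Q : ℕ → Bool) → Phase → ℕ → ℕ → Set
RunFrom : (P Q : ℕ → Bool) → Maybe Phase → ℕ → ℕ → Set
Run P Q q k zero    = Q k ≡ closingSpoke q
Run P Q q k (suc r) = RunFrom P Q (δ q (Q k , P k)) (suc k) r
RunFrom P Q nothing  k r = ⊥
RunFrom P Q (just q) k r = Run P Q q k r

Run-suc : ∀ P Q q k r → Run P Q q (suc k) r ≡ Run (P ∘ suc) (Q ∘ suc) q k r
RunFrom-suc : ∀ P Q mq k r → RunFrom P Q mq (suc k) r ≡ RunFrom (P ∘ suc) (Q ∘ suc) mq k r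
Run-suc P Q q k zero    = refl
Run-suc P Q q k (suc r) = RunFrom-suc P Q (δ q (Q (suc k) , P (suc k))) (suc k) r
RunFrom-suc P Q nothing  k r = refl
RunFrom-suc P Q (just q) k r = Run-suc P Q q k r

Accepts : ∀ {m} → Phase → Word m → Set
Accepts {m} q (ps , ss) = Run (bit ps) (bit ss) q 0 m

AcceptsAfter : ∀ {m} → Maybe Phase → Word m → Set
AcceptsAfter {m} mq (ps , ss) = RunFrom (bit ps) (bit ss) mq 0 m

Accepts-cons : ∀ {m} q l (w : Word m) → Accepts q (cons l w) ≡ AcceptsAfter (δ q l) w
Accepts-cons {m} q (s , p) (ps , ss) = RunFrom-suc (bit (p ∷ ps)) (bit (s ∷ ss)) (δ q (s , p)) 0 m

words : Phase → (m : ℕ) → List (Word m)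
wordsAfter : Maybe Phase → (m : ℕ) → List (Word m)
extensions : Phase → (m : ℕ) → Letter → List (Word (suc m))
words q zero    = [ ([] , closingSpoke q ∷ []) ]
words q (suc m) = concatMap (extensions q m) letters
extensions q m l = map (cons l) (wordsAfter (δ q l) m)
wordsAfter nothing  m = []
wordsAfter (just q) m = words q m

words-sound : ∀ q m {w} → w ∈ words q m → Accepts q w
wordsAfter-sound : ∀ mq m {w} → w ∈ wordsAfter mq m → AcceptsAfter mq w
words-sound q zero    (here refl) = refl
words-sound q (suc m) w∈ with Any.satisfied (∈-concatMap⁻ (extensions q m) {letters} w∈)
... | l , w∈l with ∈-map⁻ (cons l) w∈l
...   | w′ , w′∈ , refl = subst id (sym (Accepts-cons q l w′)) (wordsAfter-sound (δ q l) m w′∈)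
wordsAfter-sound (just q) m w∈ = words-sound q m w∈

∈-letters : ∀ l → l ∈ letters
∈-letters (true  , true)  = here refl
∈-letters (true  , false) = there (here refl)
∈-letters (false , true)  = there (there (here refl))
∈-letters (false , false) = there (there (there (here refl)))

letters-unique : Unique letters
letters-unique = ((λ ()) ∷ (λ ()) ∷ (λ ()) ∷ []) ∷ ((λ ()) ∷ (λ ()) ∷ []) ∷ ((λ ()) ∷ []) ∷ [] ∷ []

words-complete : ∀ q m (w : Word m) → Accepts q w → w ∈ words q m
wordsAfter-complete : ∀ mq m (w : Word m) → AcceptsAfter mq w → w ∈ wordsAfter mq m
words-complete q zero    ([] , _ ∷ []) refl = here refl
words-complete q (suc m) (p ∷ ps , s ∷ ss) accepted =
  ∈-concatMap⁺ (extensions q m) (Any.map (λ { refl → w∈ }) (∈-letters (s , p)))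
  where
  w∈ : (p ∷ ps , s ∷ ss) ∈ extensions q m (s , p)
  w∈ = ∈-map⁺ (cons (s , p))
         (wordsAfter-complete (δ q (s , p)) m (ps , ss) (subst id (Accepts-cons q (s , p) (ps , ss)) accepted))
wordsAfter-complete (just q) m w accepted = words-complete q m w accepted

cons-injective : ∀ {m} l {w w′ : Word m} → cons l w ≡ cons l w′ → w ≡ w′
cons-injective (s , p) {ps , ss} {ps′ , ss′} refl = refl

extensions-firstLetter : ∀ {q m l w} → w ∈ extensions q m l → firstLetter w ≡ l
extensions-firstLetter {q} {m} {l} w∈ with ∈-map⁻ (cons l) w∈
... | (ps , ss) , _ , refl = refl

words-unique : ∀ q m → Unique (words q m)
wordsAfter-unique : ∀ mq m → Unique (wordsAfter mq m)
words-unique q zero    = [] ∷ []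
words-unique q (suc m) =
  concatMap-unique letters-unique (λ l → map⁺ (cons-injective l) (wordsAfter-unique (δ q l) m))
    (λ w∈ w∈′ → trans (sym (extensions-firstLetter {q} w∈)) (extensions-firstLetter {q} w∈′))
wordsAfter-unique nothing  m = []
wordsAfter-unique (just q) m = words-unique q m

length-words : ∀ q m → length (words q m) ≡ #words q m
length-wordsAfter : ∀ mq m → length (wordsAfter mq m) ≡ #wordsAfter mq m
length-words q zero    = refl
length-words q (suc m) =
  trans (length-concatMap (extensions q m) letters)
        (cong sum (map-cong (λ l → trans (length-map (cons l) (wordsAfter (δ q l) m)) (length-wordsAfter (δ q l) m)) letters))
length-wordsAfter nothing  m = refl
length-wordsAfter (just q) m = length-words q m

module _ {n : ℕ} {S : EdgeSet n} where

  Adj-sym : ∀ {x y} → Adj n S x y → Adj n S y x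
  Adj-sym (j , b , inj₁ e) = j , b , inj₂ e
  Adj-sym (j , b , inj₂ e) = j , b , inj₁ e

  Reach-trans : ∀ {x y z} → Reach n S x y → Reach n S y z → Reach n S x z
  Reach-trans here       r′ = r′
  Reach-trans (step a r) r′ = step a (Reach-trans r r′)

  Reach-sym : ∀ {x y} → Reach n S x y → Reach n S y x
  Reach-sym here       = here
  Reach-sym (step a r) = Reach-trans (Reach-sym r) (step (Adj-sym a) here)

  Reach-closed : (C : Vtx → Set) → (∀ {x y} → Adj n S x y → C x → C y) →
                 ∀ {x y} → Reach n S x y → C x → C y
  Reach-closed C closed here       cx = cx
  Reach-closed C closed (step a r) cx = Reach-closed C closed r (closed a cx)

  connected-via : (root : Vtx) → (∀ {x} → InF n x → Reach n S x root) → Connected n S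
  connected-via root reach x y ix iy = Reach-trans (reach ix) (Reach-sym (reach iy))

module ParentPointers {n : ℕ} {S : EdgeSet n} (Parent : Vtx → Vtx → Set) (height : Vtx → ℕ)
  (parent-lower : ∀ {x y} → Parent x y → height y < height x) where

  reaches-root : (root : Vtx) → (∀ {x y} → Parent x y → Adj n S x y) →
    (∀ {x} → InF n x → x ≡ root ⊎ ∃ λ y → Parent x y × InF n y) →
    ∀ {x} → InF n x → Reach n S x root
  reaches-root root parent-adj has-parent {x} = go x (<-wellFounded (height x))
    where
    go : ∀ x → Acc _<_ (height x) → InF n x → Reach n S x root
    go x (acc rs) ix with has-parent ix
    ... | inj₁ refl           = here
    ... | inj₂ (y , p , iy) = step (parent-adj p) (go y (rs (parent-lower p)) iy)

  module _ (parent-unique : ∀ {x y z} → Parent x y → Parent x z → y ≡ z)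
           (edge-parent : ∀ {x y} → Adj n S x y → Parent x y ⊎ Parent y x) where

    NoBacktrack : List Vtx → Set
    NoBacktrack (a ∷ b ∷ c ∷ r) = a ≢ c × NoBacktrack (b ∷ c ∷ r)
    NoBacktrack _               = ⊤

    final : Vtx → Vtx → List Vtx → Vtx
    final a b []      = b
    final a b (c ∷ r) = final b c r

    EndsAscending : Vtx → Vtx → List Vtx → Set
    EndsAscending a b []      = Parent b a
    EndsAscending a b (c ∷ r) = EndsAscending b c r

    -- Parents being unique, a walk without backtracking never steps to a parent right after
    -- stepping to a child: it first moves towards the root, then away from it.
    data Shape (y₀ y₁ : Vtx) (ys : List Vtx) : Set where
      ascending  : height y₀ < height (final y₀ y₁ ys) → EndsAscending y₀ y₁ ys → Shape y₀ y₁ ys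
      descending : Parent y₀ y₁ → height (final y₀ y₁ ys) < height y₀ → Shape y₀ y₁ ys
      valley     : Parent y₀ y₁ → EndsAscending y₀ y₁ ys → Shape y₀ y₁ ys

    walk-shape : ∀ y₀ y₁ ys → Walk n S (y₀ ∷ y₁ ∷ ys) → NoBacktrack (y₀ ∷ y₁ ∷ ys) → Shape y₀ y₁ ys
    walk-shape y₀ y₁ [] (a , _) _ with edge-parent a
    ... | inj₁ p = descending p (parent-lower p)
    ... | inj₂ p = ascending (parent-lower p) p
    walk-shape y₀ y₁ (y₂ ∷ ys) (a , w) (y₀≢y₂ , nb) with edge-parent a | walk-shape y₁ y₂ ys w nb
    ... | inj₁ p | ascending _ up   = valley p up
    ... | inj₁ p | descending _ lt  = descending p (<-trans lt (parent-lower p))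
    ... | inj₁ p | valley _ up      = valley p up
    ... | inj₂ p | ascending lt up  = ascending (<-trans (parent-lower p) lt) up
    ... | inj₂ p | descending p′ _  = ⊥-elim (y₀≢y₂ (parent-unique p p′))
    ... | inj₂ p | valley p′ _      = ⊥-elim (y₀≢y₂ (parent-unique p p′))

    final-snoc : ∀ a b cs z → final a b (cs ++ [ z ]) ≡ z
    final-snoc a b []       z = refl
    final-snoc a b (c ∷ cs) z = final-snoc b c cs z

    EndsAscending-snoc : ∀ a b c cs z → EndsAscending a b (c ∷ cs ++ [ z ]) → ∃ λ u → u ∈ c ∷ cs × Parent z u
    EndsAscending-snoc a b c []       z p = c , here refl , p
    EndsAscending-snoc a b c (d ∷ cs) z p with EndsAscending-snoc b c d cs z p
    ... | u , u∈ , q = u , there u∈ , q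

    NoBacktrack-snoc : ∀ l z → Unique l → All (z ≢_) l → NoBacktrack (l ++ [ z ])
    NoBacktrack-snoc []                z _ _ = tt
    NoBacktrack-snoc (x ∷ [])          z _ _ = tt
    NoBacktrack-snoc (x ∷ y ∷ [])      z _ (z≢x ∷ _) = (λ x≡z → z≢x (sym x≡z)) , tt
    NoBacktrack-snoc (x ∷ y ∷ w ∷ r) z ((_ ∷ x≢w ∷ _) ∷ u) (_ ∷ z∉) = x≢w , NoBacktrack-snoc (y ∷ w ∷ r) z u z∉

    acyclic : Acyclic n S
    acyclic ([] , ())
    acyclic (x₀ ∷ [] , (s≤s () , _))
    acyclic (x₀ ∷ x₁ ∷ [] , (s≤s (s≤s ()) , _))
    acyclic (x₀ ∷ x₁ ∷ x₂ ∷ r , _ , (x₀∉@(_ ∷ x₀≢x₂ ∷ _) ∷ u@(x₁∉ ∷ _)) , w)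
      with walk-shape x₀ x₁ (x₂ ∷ r ++ [ x₀ ]) w (x₀≢x₂ , NoBacktrack-snoc (x₁ ∷ x₂ ∷ r) x₀ u x₀∉)
    ... | ascending lt _  = <-irrefl (sym (cong height (final-snoc x₁ x₂ r x₀))) lt
    ... | descending _ lt = <-irrefl (cong height (final-snoc x₁ x₂ r x₀)) lt
    ... | valley p up with EndsAscending-snoc x₀ x₁ x₂ r x₀ up
    ...   | u′ , u′∈ , q = All.lookup x₁∉ u′∈ (parent-unique p q)

data FanEdge (P Q : ℕ → Bool) : Vtx → Vtx → Set where
  rim   : ∀ {k} → P k ≡ true → FanEdge P Q (v (2 + k)) (v (3 + k))
  spoke : ∀ {k} → Q k ≡ true → FanEdge P Q (v (2 + k)) v∞

FanAdj : (P Q : ℕ → Bool) → Vtx → Vtx → Set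
FanAdj P Q x y = FanEdge P Q x y ⊎ FanEdge P Q y x

rimEdge spokeEdge : ℕ → Edge
rimEdge   k = (v (2 + k) , v (3 + k))
spokeEdge k = (v (2 + k) , v∞)

v-injective : ∀ {i j} → v i ≡ v j → i ≡ j
v-injective refl = refl

_≟ᵥ_ : DecidableEquality Vtx
v∞  ≟ᵥ v∞  = yes refl
v∞  ≟ᵥ v _ = no λ ()
v _ ≟ᵥ v∞  = no λ ()
v i ≟ᵥ v j = Dec.map′ (cong v) v-injective (i ≟ j)

_≟ₑ_ : DecidableEquality Edge
_≟ₑ_ = ≡-dec _≟ᵥ_ _≟ᵥ_

bitAt : (es : List Edge) → Vec Bool (length es) → Edge → Bool
bitAt []       []      e = false
bitAt (x ∷ es) (b ∷ S) e = if does (x ≟ₑ e) then b else bitAt es S e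

V-lookup-mark : ∀ es f j → V.lookup (mark es f) j ≡ f (L.lookup es j)
V-lookup-mark (x ∷ es) f Fin.zero    = refl
V-lookup-mark (x ∷ es) f (Fin.suc j) = V-lookup-mark es f j

bitAt-mark : ∀ {es} f {e} → e ∈ es → bitAt es (mark es f) e ≡ f e
bitAt-mark {x ∷ es} f {e} e∈ with x ≟ₑ e | e∈
... | yes refl | _         = refl
... | no x≢e   | here refl = ⊥-elim (x≢e refl)
... | no _     | there e∈′ = bitAt-mark f e∈′

mark-bitAt : ∀ {es} f (S : Vec Bool (length es)) → Unique es →
  (∀ {e} → e ∈ es → f e ≡ bitAt es S e) → mark es f ≡ S
mark-bitAt {[]}     f []      _          agree = refl
mark-bitAt {x ∷ es} f (b ∷ S) (x∉ ∷ u) agree =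
  cong₂ _∷_ (trans (agree (here refl)) (cong (if_then b else bitAt es S x) (dec-true (x ≟ₑ x) refl)))
            (mark-bitAt f S u λ e∈ → trans (agree (there e∈))
              (cong (if_then b else _) (dec-false (x ≟ₑ _) (All.lookup x∉ e∈))))

bit-true⇒< : ∀ {n} (bs : Vec Bool n) {k} → bit bs k ≡ true → k < n
bit-true⇒< []       ()
bit-true⇒< (b ∷ bs) {zero}  _ = z<s
bit-true⇒< (b ∷ bs) {suc k} e = s<s (bit-true⇒< bs e)

bits : (n : ℕ) → (ℕ → Bool) → Vec Bool n
bits zero    g = []
bits (suc n) g = g 0 ∷ bits n (g ∘ suc)

bit-bits : ∀ n g {k} → k < n → bit (bits n g) k ≡ g k
bit-bits (suc n) g {zero}  _       = refl
bit-bits (suc n) g {suc k} (s<s k<n) = bit-bits n (g ∘ suc) k<n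

bits-bit : ∀ {n} (bs : Vec Bool n) g → (∀ {k} → k < n → g k ≡ bit bs k) → bits n g ≡ bs
bits-bit []       g agree = refl
bits-bit (b ∷ bs) g agree = cong₂ _∷_ (agree z<s) (bits-bit bs (g ∘ suc) (agree ∘ s<s))

module _ {m : ℕ} where

  rim∈edges : ∀ {k} → k < m → rimEdge k ∈ edges (2 + m)
  rim∈edges k<m = ∈-++⁺ˡ (∈-map⁺ rimEdge (∈-upTo⁺ k<m))

  spoke∈edges : ∀ {k} → k < suc m → spokeEdge k ∈ edges (2 + m)
  spoke∈edges k≤m = ∈-++⁺ʳ (map rimEdge (upTo m)) (∈-map⁺ spokeEdge (∈-upTo⁺ k≤m))

  ∈edges⁻ : ∀ {e} → e ∈ edges (2 + m) →
    (∃ λ k → k < m × e ≡ rimEdge k) ⊎ (∃ λ k → k < suc m × e ≡ spokeEdge k)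
  ∈edges⁻ e∈ with ∈-++⁻ (map rimEdge (upTo m)) e∈
  ... | inj₁ e∈rims   with ∈-map⁻ rimEdge e∈rims
  ...   | k , k∈ , e≡ = inj₁ (k , ∈-upTo⁻ k∈ , e≡)
  ∈edges⁻ e∈ | inj₂ e∈spokes with ∈-map⁻ spokeEdge e∈spokes
  ...   | k , k∈ , e≡ = inj₂ (k , ∈-upTo⁻ k∈ , e≡)

  edges-unique : Unique (edges (2 + m))
  edges-unique = ++⁺ (map⁺ (λ { refl → refl }) (upTo⁺ m)) (map⁺ (λ { refl → refl }) (upTo⁺ (suc m))) disjoint
    where
    disjoint : ∀ {e} → e ∈ map rimEdge (upTo m) × e ∈ map spokeEdge (upTo (suc m)) → ⊥
    disjoint (e∈rims , e∈spokes) with ∈-map⁻ rimEdge e∈rims | ∈-map⁻ spokeEdge e∈spokes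
    ... | _ , _ , refl | _ , _ , ()

  present : Word m → Edge → Bool
  present (ps , ss) (v (suc (suc k)) , v j) = does (j ≟ 3 + k) ∧ bit ps k
  present (ps , ss) (v (suc (suc k)) , v∞)  = bit ss k
  present _         _                       = false

  present-rim : ∀ w k → present w (rimEdge k) ≡ bit (proj₁ w) k
  present-rim (ps , ss) k = cong (_∧ bit ps k) (dec-true (3 + k ≟ 3 + k) refl)

  present-sound : ∀ (w : Word m) {x y} → present w (x , y) ≡ true → FanEdge (bit (proj₁ w)) (bit (proj₂ w)) x y
  present-sound (ps , ss) {v (suc (suc k))} {v j} e with j ≟ 3 + k
  ... | yes refl = rim (trans (sym (present-rim (ps , ss) k)) e)
  ... | no  j≢   with () ← trans (sym e) (cong (_∧ bit ps k) (dec-false (j ≟ 3 + k) j≢))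
  present-sound (ps , ss) {v (suc (suc k))} {v∞} e = spoke e

  present-complete : ∀ (w : Word m) {x y} → FanEdge (bit (proj₁ w)) (bit (proj₂ w)) x y →
    present w (x , y) ≡ true × (x , y) ∈ edges (2 + m)
  present-complete (ps , ss) (rim {k} e)   = trans (present-rim (ps , ss) k) e , rim∈edges (bit-true⇒< ps e)
  present-complete (ps , ss) (spoke {k} e) = e , spoke∈edges (bit-true⇒< ss e)

  encode : Word m → EdgeSet (2 + m)
  encode w = mark (edges (2 + m)) (present w)

  decode : EdgeSet (2 + m) → Word m
  decode S = bits m (bitAt (edges (2 + m)) S ∘ rimEdge) , bits (suc m) (bitAt (edges (2 + m)) S ∘ spokeEdge)

  decode-encode : ∀ w → decode (encode w) ≡ w
  decode-encode (ps , ss) = cong₂ _,_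
    (bits-bit ps _ λ k<m → trans (bitAt-mark (present (ps , ss)) (rim∈edges k<m)) (present-rim (ps , ss) _))
    (bits-bit ss _ λ k≤m → bitAt-mark (present (ps , ss)) (spoke∈edges k≤m))

  encode-decode : ∀ S → encode (decode S) ≡ S
  encode-decode S = mark-bitAt (present (decode S)) S edges-unique agree
    where
    agree : ∀ {e} → e ∈ edges (2 + m) → present (decode S) e ≡ bitAt (edges (2 + m)) S e
    agree e∈ with ∈edges⁻ e∈
    ... | inj₁ (k , k<m , refl) = trans (present-rim (decode S) k) (bit-bits m (bitAt (edges (2 + m)) S ∘ rimEdge) k<m)
    ... | inj₂ (k , k≤m , refl) = bit-bits (suc m) (bitAt (edges (2 + m)) S ∘ spokeEdge) k≤m

  encode-injective : ∀ {w w′} → encode w ≡ encode w′ → w ≡ w′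
  encode-injective {w} {w′} e = trans (sym (decode-encode w)) (trans (cong decode e) (decode-encode w′))

  encode-adjacent : ∀ (w : Word m) {x y} → Adj (2 + m) (encode w) x y ⇔ FanAdj (bit (proj₁ w)) (bit (proj₂ w)) x y
  encode-adjacent w = mk⇔ adj⇒fan fan⇒adj
    where
    present-at : ∀ j → V.lookup (encode w) j ≡ true → present w (L.lookup (edges (2 + m)) j) ≡ true
    present-at j b = trans (sym (V-lookup-mark (edges (2 + m)) (present w) j)) b
    adj⇒fan : ∀ {x y} → Adj (2 + m) (encode w) x y → FanAdj _ _ x y
    adj⇒fan (j , b , inj₁ e) = inj₁ (present-sound w (subst (λ e → present w e ≡ true) e (present-at j b)))
    adj⇒fan (j , b , inj₂ e) = inj₂ (present-sound w (subst (λ e → present w e ≡ true) e (present-at j b)))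
    edge-listed : ∀ {x y} → FanEdge _ _ x y → ∃ λ j → V.lookup (encode w) j ≡ true × L.lookup (edges (2 + m)) j ≡ (x , y)
    edge-listed e with present-complete w e
    ... | p , e∈ = Any.index e∈ , trans (V-lookup-mark (edges (2 + m)) (present w) _)
                                     (subst (λ e → present w e ≡ true) (lookup-index e∈) p)
                                 , sym (lookup-index e∈)
    fan⇒adj : ∀ {x y} → FanAdj _ _ x y → Adj (2 + m) (encode w) x y
    fan⇒adj (inj₁ e) with edge-listed e
    ... | j , b , e≡ = j , b , inj₁ e≡
    fan⇒adj (inj₂ e) with edge-listed e
    ... | j , b , e≡ = j , b , inj₂ e≡

AllIn : (ℕ → Set) → ℕ → ℕ → Set
AllIn X a b = ∀ {i} → a ≤ i → i < b → X i

AllIn-empty : ∀ X a → AllIn X a a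
AllIn-empty X a a≤i i<a = ⊥-elim (≤⇒≯ a≤i i<a)

AllIn-snoc : ∀ {X a b} → AllIn X a b → X b → AllIn X a (suc b)
AllIn-snoc xs x a≤i i<1+b with m<1+n⇒m<n∨m≡n i<1+b
... | inj₁ i<b  = xs a≤i i<b
... | inj₂ refl = x

RunFrom-just : ∀ {P Q mq k r} → RunFrom P Q mq k r → ∃ λ q → mq ≡ just q × Run P Q q k r
RunFrom-just {mq = just q} run = q , refl , run

module _ (m : ℕ) (P Q : ℕ → Bool)
  (rim-range : ∀ {k} → P k ≡ true → k < m)
  (spoke-range : ∀ {k} → Q k ≡ true → k < suc m)
  (S : EdgeSet (2 + m))
  (adjacent : ∀ {x y} → Adj (2 + m) S x y ⇔ FanAdj P Q x y) where

  next : Maybe Phase → ℕ → Maybe Phase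
  next nothing  k = nothing
  next (just q) k = δ q (Q k , P k)

  phase : ℕ → Maybe Phase
  phase zero    = just spokeless
  phase (suc k) = next (phase k) k

  spoked-run : ∀ {k r} → Run P Q spoked k r → Q k ≡ false
  spoked-run {k} {zero}  run = run
  spoked-run {k} {suc r} run with Q k
  ... | false = refl

  spokeless-run : ∀ {k r} → Run P Q spokeless k r → Q k ≡ false →
    P k ≡ true × ∃ λ r′ → r ≡ suc r′ × Run P Q spokeless (suc k) r′
  spokeless-run {k} {zero} run Q≡ with Q k
  spokeless-run {k} {zero} run () | true
  spokeless-run {k} {suc r} run Q≡ with Q k | P k in P≡
  spokeless-run {k} {suc r} run () | true | _
  ... | false | true = refl , r , refl , run

  module FromAcceptingRun (accepting : Run P Q spokeless 0 m) where

    phase-run : ∀ k r → k + r ≡ m → ∃ λ q → phase k ≡ just q × Run P Q q k r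
    phase-run zero    r refl = spokeless , refl , accepting
    phase-run (suc k) r k+r≡m with phase-run k (suc r) (trans (+-suc k r) k+r≡m)
    ... | q , ph , run with RunFrom-just run
    ...   | q′ , δ≡ , run′ = q′ , trans (cong (λ mq → next mq k) ph) δ≡ , run′

    run-at : ∀ {k q} → k ≤ m → phase k ≡ just q → ∃ λ r → k + r ≡ m × Run P Q q k r
    run-at {k} k≤m ph with m≤n⇒∃[o]m+o≡n k≤m
    ... | r , k+r≡m with phase-run k r k+r≡m
    ...   | q , ph′ , run with trans (sym ph) ph′
    ...     | refl = r , k+r≡m , run

    phase-defined : ∀ {k} → k ≤ m → ∃ λ q → phase k ≡ just q
    phase-defined {k} k≤m with m≤n⇒∃[o]m+o≡n k≤m
    ... | r , k+r≡m with phase-run k r k+r≡m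
    ...   | q , ph , _ = q , ph

    spoked-at : ∀ {k} → k ≤ m → phase k ≡ just spoked → Q k ≡ false
    spoked-at {k} k≤m ph with run-at k≤m ph
    ... | r , _ , run = spoked-run {k} {r} run

    -- A vertex without spoke points to its neighbour towards the spoke of its block.
    parentOf : Bool → Phase → ℕ → Vtx
    parentOf true  q         k = v∞
    parentOf false spokeless k = v (3 + k)
    parentOf false spoked    k = v (1 + k)

    heightOf : Bool → Phase → ℕ → ℕ
    heightOf true  q         k = 1
    heightOf false spokeless k = 2 + (m ∸ k)
    heightOf false spoked    k = 2 + k

    heightFrom : Maybe Phase → ℕ → ℕ
    heightFrom nothing  k = 0
    heightFrom (just q) k = heightOf (Q k) q k

    height : Vtx → ℕ
    height (v (suc (suc k))) = heightFrom (phase k) k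
    height _                 = 0

    data Parent : Vtx → Vtx → Set where
      parent : ∀ {k q} → k ≤ m → phase k ≡ just q → Parent (v (2 + k)) (parentOf (Q k) q k)

    rightward : ∀ {k} → k ≤ m → phase k ≡ just spokeless → Q k ≡ false →
      P k ≡ true × k < m × phase (suc k) ≡ just spokeless
    rightward {k} k≤m ph Q≡ with run-at k≤m ph
    ... | r , k+r≡m , run with spokeless-run {k} {r} run Q≡
    ...   | P≡ , r′ , refl , _ =
      P≡ , subst (k <_) k+r≡m (m<m+n k (s≤s z≤n))
         , trans (cong (λ mq → next mq k) ph) (cong₂ (λ s p → δ spokeless (s , p)) Q≡ P≡)

    leftward : ∀ mq k → next mq k ≡ just spoked → P k ≡ true × heightFrom mq k ≤ 2 + k
    leftward (just spokeless) k ph with Q k | P k | ph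
    ... | true  | true  | _  = refl , s≤s z≤n
    ... | true  | false | ()
    ... | false | true  | ()
    leftward (just spoked)    k ph with Q k | P k | ph
    ... | false | true  | _  = refl , ≤-refl
    ... | false | false | ()

    heightOf-spokeless : ∀ b k → heightOf b spokeless k ≤ 2 + (m ∸ k)
    heightOf-spokeless true  k = s≤s z≤n
    heightOf-spokeless false k = ≤-refl

    parent-step : ∀ {k q} → k ≤ m → phase k ≡ just q →
      FanAdj P Q (v (2 + k)) (parentOf (Q k) q k) ×
      height (parentOf (Q k) q k) < heightOf (Q k) q k ×
      InF (2 + m) (parentOf (Q k) q k)
    parent-step {k} {q} k≤m ph with Q k in Q≡
    ... | true = inj₁ (spoke Q≡) , s≤s z≤n , tt
    parent-step {k} {spokeless} k≤m ph | false with rightward k≤m ph Q≡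
    ... | P≡ , k<m , ph′ = inj₁ (rim P≡) , lower , (s≤s (s≤s z≤n) , s≤s (s≤s k<m))
      where
      open ≤-Reasoning
      lower : heightFrom (phase (suc k)) (suc k) < 2 + (m ∸ k)
      lower = begin-strict
          heightFrom (phase (suc k)) (suc k)
        ≡⟨ cong (λ mq → heightFrom mq (suc k)) ph′ ⟩
          heightOf (Q (suc k)) spokeless (suc k)
        ≤⟨ heightOf-spokeless (Q (suc k)) (suc k) ⟩
          2 + (m ∸ suc k)
        <⟨ +-monoʳ-< 2 (∸-monoʳ-< (n<1+n k) k<m) ⟩
          2 + (m ∸ k)
        ∎
    parent-step {suc k} {spoked} k≤m ph | false with leftward (phase k) k ph
    ... | P≡ , h≤ = inj₂ (rim P≡) , s≤s h≤ , (s≤s (s≤s z≤n) , s≤s (s≤s (<⇒≤ k≤m)))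

    parent-lower : ∀ {x y} → Parent x y → height y < height x
    parent-lower (parent {k} {q} k≤m ph) =
      subst (height (parentOf (Q k) q k) <_) (sym (cong (λ mq → heightFrom mq k) ph)) (proj₁ (proj₂ (parent-step k≤m ph)))

    parent-unique : ∀ {x y z} → Parent x y → Parent x z → y ≡ z
    parent-unique (parent _ ph) (parent _ ph′) with trans (sym ph) ph′
    ... | refl = refl

    has-parent : ∀ {x} → InF (2 + m) x → x ≡ v∞ ⊎ ∃ λ y → Parent x y × InF (2 + m) y
    has-parent {v∞}              _                  = inj₁ refl
    has-parent {v zero}          (() , _)
    has-parent {v (suc zero)}    (s≤s () , _)
    has-parent {v (suc (suc k))} (_ , s≤s (s≤s k≤m)) with phase-defined k≤m
    ... | q , ph = inj₂ (_ , parent k≤m ph , proj₂ (proj₂ (parent-step k≤m ph)))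

    after-rim : ∀ {k} → k < m → P k ≡ true → phase (suc k) ≡ just spoked ⊎ (phase k ≡ just spokeless × Q k ≡ false)
    after-rim {k} k<m P≡ with phase-defined (<⇒≤ k<m)
    ... | spoked , ph =
      inj₁ (trans (cong (λ mq → next mq k) ph)
                  (cong₂ (λ s p → δ spoked (s , p)) (spoked-at (<⇒≤ k<m) ph) P≡))
    ... | spokeless , ph with Q k in Q≡
    ...   | false = inj₂ (ph , refl)
    ...   | true  = inj₁ (trans (cong (λ mq → next mq k) ph) (cong₂ (λ s p → δ spokeless (s , p)) Q≡ P≡))

    edge-parent : ∀ {x y} → FanEdge P Q x y → Parent x y ⊎ Parent y x
    edge-parent (spoke {k} Q≡) with phase-defined (≤-pred (spoke-range Q≡))
    ... | q , ph = inj₁ (subst (Parent (v (2 + k))) (cong (λ b → parentOf b q k) Q≡) (parent (≤-pred (spoke-range Q≡)) ph))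
    edge-parent (rim {k} P≡) with after-rim (rim-range P≡) P≡
    ... | inj₂ (ph , Q≡) =
      inj₁ (subst (Parent (v (2 + k))) (cong (λ b → parentOf b spokeless k) Q≡) (parent (<⇒≤ (rim-range P≡)) ph))
    ... | inj₁ ph =
      inj₂ (subst (Parent (v (3 + k))) (cong (λ b → parentOf b spoked (suc k)) (spoked-at (rim-range P≡) ph))
                  (parent (rim-range P≡) ph))

    spanning-tree : IsSpanningTree (2 + m) S
    spanning-tree = connected-via v∞ (reaches-root v∞ (from adjacent ∘ parent-adjacent) has-parent)
                  , acyclic parent-unique adj-parent
      where
      open ParentPointers {2 + m} {S} Parent height parent-lower
      parent-adjacent : ∀ {x y} → Parent x y → FanAdj P Q x y
      parent-adjacent (parent k≤m ph) = proj₁ (parent-step k≤m ph)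
      adj-parent : ∀ {x y} → Adj (2 + m) S x y → Parent x y ⊎ Parent y x
      adj-parent a with to adjacent a
      ... | inj₁ e = edge-parent e
      ... | inj₂ e = Sum.swap (edge-parent e)

  data BlockStart : ℕ → Set where
    first     : BlockStart 0
    after-cut : ∀ {i} → P i ≡ false → BlockStart (suc i)

  cut-before : ∀ {i} → BlockStart (suc i) → P i ≡ false
  cut-before (after-cut P≡) = P≡

  Block : Phase → ℕ → Set
  Block spokeless k = ∃ λ j → BlockStart j × j ≤ k × AllIn (λ i → Q i ≡ false × P i ≡ true) j k
  Block spoked    k = ∃ λ r → r < k × Q r ≡ true × AllIn (λ i → P i ≡ true) r k

  fresh-block : ∀ {k} → P k ≡ false → Block spokeless (suc k)
  fresh-block {k} P≡ = suc k , after-cut P≡ , ≤-refl , AllIn-empty (λ i → Q i ≡ false × P i ≡ true) (suc k)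

  rimPath : ℕ → ℕ → List Vtx
  rimTail : ℕ → ℕ → List Vtx
  rimPath a d       = v (2 + a) ∷ rimTail a d
  rimTail a zero    = []
  rimTail a (suc d) = rimPath (suc a) d

  rimPath-above : ∀ {a b} d → a < b → All (v (2 + a) ≢_) (rimPath b d)
  rimPath-above zero    a<b = (λ { refl → <-irrefl refl a<b }) ∷ []
  rimPath-above (suc d) a<b = (λ { refl → <-irrefl refl a<b }) ∷ rimPath-above d (m<n⇒m<1+n a<b)

  rimPath-unique : ∀ a d → Unique (rimPath a d)
  rimPath-unique a zero    = [] ∷ []
  rimPath-unique a (suc d) = rimPath-above d (n<1+n a) ∷ rimPath-unique (suc a) d

  rimPath-hubless : ∀ a d → All (v∞ ≢_) (rimPath a d)
  rimPath-hubless a zero    = (λ ()) ∷ []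
  rimPath-hubless a (suc d) = (λ ()) ∷ rimPath-hubless (suc a) d

  rimPath-walk : ∀ a d → AllIn (λ i → P i ≡ true) a (a + d) → Q (a + d) ≡ true →
    Walk (2 + m) S (rimPath a d ++ [ v∞ ])
  rimPath-walk a zero    rims Q≡ = from adjacent (inj₁ (spoke (subst (λ i → Q i ≡ true) (+-identityʳ a) Q≡))) , tt
  rimPath-walk a (suc d) rims Q≡ =
    from adjacent (inj₁ (rim (rims ≤-refl (m<m+n a (s≤s z≤n))))) ,
    rimPath-walk (suc a) d (λ {i} a<i i< → rims (<⇒≤ a<i) (subst (i <_) (sym (+-suc a d)) i<))
                           (subst (λ i → Q i ≡ true) (+-suc a d) Q≡)

  module FromSpanningTree (tree : IsSpanningTree (2 + m) S) where

    spoke-cycle : ∀ {r k} → r < k → Q r ≡ true → Q k ≡ true → AllIn (λ i → P i ≡ true) r k →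
      ∃ λ c → IsCycle (2 + m) S c
    spoke-cycle {r} {k} r<k Qr Qk rims with m≤n⇒∃[o]m+o≡n r<k
    ... | d , 1+r+d≡k =
      v∞ ∷ rimPath r (suc d) ,
      s≤s (s≤s (s≤s z≤n)) ,
      rimPath-hubless r (suc d) ∷ rimPath-unique r (suc d) ,
      from adjacent (inj₂ (spoke Qr)) ,
      rimPath-walk r (suc d) (λ {i} r≤i i< → rims r≤i (subst (i <_) r+1+d≡k i<)) (subst (λ i → Q i ≡ true) (sym r+1+d≡k) Qk)
      where
      r+1+d≡k : r + suc d ≡ k
      r+1+d≡k = trans (+-suc r d) 1+r+d≡k

    isolated : ∀ {j k} → BlockStart j → j ≤ k → AllIn (λ i → Q i ≡ false × P i ≡ true) j k →
      Q k ≡ false → P k ≡ false → ¬ Reach (2 + m) S (v (2 + k)) v∞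
    isolated {j} {k} start j≤k block Qk Pk reach = Reach-closed C (λ a → closed (to adjacent a)) reach (j≤k , ≤-refl)
      where
      C : Vtx → Set
      C (v (suc (suc t))) = j ≤ t × t ≤ k
      C _                 = ⊥
      closed : ∀ {x y} → FanAdj P Q x y → C x → C y
      closed (inj₁ (rim {t} P≡)) (j≤t , t≤k) with m≤n⇒m<n∨m≡n t≤k
      ... | inj₁ t<k  = m≤n⇒m≤1+n j≤t , t<k
      ... | inj₂ refl = ⊥-elim (not-¬ P≡ Pk)
      closed (inj₁ (spoke {t} Q≡)) (j≤t , t≤k) with m≤n⇒m<n∨m≡n t≤k
      ... | inj₁ t<k  = not-¬ Q≡ (proj₁ (block j≤t t<k))
      ... | inj₂ refl = not-¬ Q≡ Qk
      closed (inj₂ (rim {t} P≡)) (j≤1+t , 1+t≤k) with m≤n⇒m<n∨m≡n j≤1+t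
      ... | inj₁ j<1+t = ≤-pred j<1+t , ≤-trans (n≤1+n t) 1+t≤k
      ... | inj₂ refl  = ⊥-elim (not-¬ P≡ (cut-before start))

    in-fan : ∀ {k r} → k + r ≡ m → InF (2 + m) (v (2 + k))
    in-fan {k} {r} k+r≡m = s≤s (s≤s z≤n) , s≤s (s≤s (subst (k ≤_) k+r≡m (m≤m+n k r)))

    run-from-block : ∀ q k r → k + r ≡ m → Block q k → Run P Q q k r
    run-from-block spokeless k zero k+0≡m (j , start , j≤k , block) with Q k in Qk | P k in Pk
    ... | true  | _     = refl
    ... | false | true  = ⊥-elim (<-irrefl (trans (sym (+-identityʳ k)) k+0≡m) (rim-range Pk))
    ... | false | false = ⊥-elim (isolated start j≤k block Qk Pk (proj₁ tree (v (2 + k)) v∞ (in-fan k+0≡m) tt))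
    run-from-block spoked k zero k+0≡m (r , r<k , Qr , rims) with Q k in Qk
    ... | false = refl
    ... | true  = ⊥-elim (proj₂ tree (spoke-cycle r<k Qr Qk rims))
    run-from-block spokeless k (suc r) k+1+r≡m (j , start , j≤k , block) with Q k in Qk | P k in Pk
    ... | true  | true  = run-from-block spoked (suc k) r (trans (sym (+-suc k r)) k+1+r≡m)
                            (k , n<1+n k , Qk , AllIn-snoc (AllIn-empty (λ i → P i ≡ true) k) Pk)
    ... | true  | false = run-from-block spokeless (suc k) r (trans (sym (+-suc k r)) k+1+r≡m) (fresh-block Pk)
    ... | false | true  = run-from-block spokeless (suc k) r (trans (sym (+-suc k r)) k+1+r≡m)
                            (j , start , m≤n⇒m≤1+n j≤k , AllIn-snoc block (Qk , Pk))
    ... | false | false = ⊥-elim (isolated start j≤k block Qk Pk (proj₁ tree (v (2 + k)) v∞ (in-fan k+1+r≡m) tt))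
    run-from-block spoked k (suc r) k+1+r≡m (r′ , r′<k , Qr′ , rims) with Q k in Qk | P k in Pk
    ... | true  | _     = ⊥-elim (proj₂ tree (spoke-cycle r′<k Qr′ Qk rims))
    ... | false | true  = run-from-block spoked (suc k) r (trans (sym (+-suc k r)) k+1+r≡m)
                            (r′ , m<n⇒m<1+n r′<k , Qr′ , AllIn-snoc rims Pk)
    ... | false | false = run-from-block spokeless (suc k) r (trans (sym (+-suc k r)) k+1+r≡m) (fresh-block Pk)

    accepting : Run P Q spokeless 0 m
    accepting = run-from-block spokeless 0 m refl (0 , first , z≤n , AllIn-empty (λ i → Q i ≡ false × P i ≡ true) 0)

  spanning-tree⇔accepting : IsSpanningTree (2 + m) S ⇔ Run P Q spokeless 0 m
  spanning-tree⇔accepting = mk⇔ FromSpanningTree.accepting FromAcceptingRun.spanning-tree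

spanning-tree⇔accepted : ∀ {m} (w : Word m) → IsSpanningTree (2 + m) (encode w) ⇔ Accepts spokeless w
spanning-tree⇔accepted {m} w@(ps , ss) =
  spanning-tree⇔accepting m (bit ps) (bit ss) (bit-true⇒< ps) (bit-true⇒< ss) (encode w) (encode-adjacent w)

spanning-trees : ∀ m → NumSpanningTrees (2 + m) (#words spokeless m)
spanning-trees m =
  map encode (words spokeless m) ,
  map⁺ encode-injective (words-unique spokeless m) ,
  (λ S → mk⇔ (listed S) (spanning S)) ,
  trans (length-map encode (words spokeless m)) (length-words spokeless m)
  where
  listed : ∀ S → IsSpanningTree (2 + m) S → S ∈ map encode (words spokeless m)
  listed S tree =
    subst (_∈ _) (encode-decode S)
      (∈-map⁺ encode (words-complete spokeless m (decode S)
        (to (spanning-tree⇔accepted (decode S)) (subst (IsSpanningTree (2 + m)) (sym (encode-decode S)) tree))))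
  spanning : ∀ S → S ∈ map encode (words spokeless m) → IsSpanningTree (2 + m) S
  spanning S S∈ with ∈-map⁻ encode S∈
  ... | w , w∈ , refl = from (spanning-tree⇔accepted w) (words-sound spokeless m w∈)

lemma1 : (n : ℕ) → 2 ≤ n →
    NumSpanningTrees n (length (LIST n)) × NumSpanningTrees n (length (REVLIST n))
lemma1 (suc (suc m)) (s≤s (s≤s z≤n)) with spanning-trees m
... | Ts , unique , spanning , length≡ =
  (Ts , unique , spanning , trans length≡ (sym (length-LIST m))) ,
  (Ts , unique , spanning , trans length≡ (sym (length-REVLIST m)))
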